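{- Let $k\ge3$, $\eta\in\mathbb{R}$, and let $G$ be a (weakly connected) $k$-regular digraph equipped with its $\eta$-function $\theta$. Let $U=U(G^{\pm})$ be the Grover transfer matrix of $G^{\pm}$ and for arcs $a,b\in A(G)^{\pm1}$ set $\mathcal{A}(a,b)=\{z\in A(G)^{\pm1}\mid e^{ -i\theta(z)}U_{az}U_{zb}\ne0\}$. Then $|\mathcal{A}(a,b)|\le1$, and equality holds if and only if exactly one of the following happens: (i) $a=b$; (ii) $o(a)=o(b)$ and $a\ne b$; (iii) $t(a)=t(b)$ and $a\ne b$; (iv) $t(b)$ is adjacent to $o(a)$ in $G^{\pm}$, but $a,b$ are in none of the cases (i), (ii), (iii).
   Context: A digraph $G$ has finite vertex set $V(G)$ and arc set $A(G)\subseteq V(G)\times V(G)\setminus\{(x,x)\}$. For $a=(u,v)$: $o(a)=u$, $t(a)=v$, $a^{ -1}=(v,u)$; $A(G)^{\pm1}=A(G)\cup A(G)^{ -1}$. $G^{\pm}=(V(G),A(G)^{\pm1})$ is the underlying simple undirected graph, assumed connected; $G$ is $k$-regular if every vertex has degree $k$ in $G^{\pm}$. The $\eta$-function: $\theta(a)=\eta$ if $a\in A(G)\setminus A(G)^{ -1}$, $-\eta$ if $a\in A(G)^{ -1}\setminus A(G)$, $0$ if $a\in A(G)\cap A(G)^{ -1}$. The Grover transfer matrix of $G^{\pm}$ is indexed by $A(G)^{\pm1}$ with $U_{ab}=\frac{2}{\deg t(b)}\delta_{t(b),o(a)}-\delta_{a^{ -1},b}$. -}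

module Defs where

open import Data.Bool using (Bool; true; false; T; _∨_; if_then_else_)
open import Data.Nat using (ℕ; zero; suc)
open import Data.Fin using (Fin) renaming (_≟_ to _≟ᶠ_)
open import Data.List using (List; length; filter; concatMap; map)
open import Data.List.Base using (allFin)
open import Data.Product using (_×_; _,_; proj₁; proj₂)
open import Data.Sum using (_⊎_)
open import Data.Integer using (+_)
open import Data.Rational using (ℚ; 0ℚ; 1ℚ; _/_; _-_; _*_) renaming (_≟_ to _≟ℚ_)
open import Relation.Nullary using (¬_; Dec; does)
open import Relation.Nullary.Decidable using (T?; ¬?)
open import Relation.Binary.PropositionalEquality using (_≡_)
open import Data.Product.Properties using (≡-dec)

-- A digraph on vertex set Fin n, given by a Boolean arc relation
-- (arc (u,v) present iff arcRel u v ≡ true). Loops are excluded by a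
-- hypothesis in the statement.
Vertex : ℕ → Set
Vertex n = Fin n

Pair : ℕ → Set
Pair n = Fin n × Fin n

o : ∀ {n} → Pair n → Fin n
o = proj₁

t : ∀ {n} → Pair n → Fin n
t = proj₂

inv : ∀ {n} → Pair n → Pair n
inv (u , v) = (v , u)

symAdj : ∀ {n} → (Fin n → Fin n → Bool) → Fin n → Fin n → Bool
symAdj A u v = A u v ∨ A v u

IsArc± : ∀ {n} → (Fin n → Fin n → Bool) → Pair n → Set
IsArc± A (u , v) = T (symAdj A u v)

deg : ∀ {n} → (Fin n → Fin n → Bool) → Fin n → ℕ
deg {n} A v = length (filter (λ w → T? (symAdj A v w)) (allFin n))

Regular : ∀ {n} → (Fin n → Fin n → Bool) → ℕ → Set
Regular {n} A k = ∀ (v : Fin n) → deg A v ≡ k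

data Walk {n} (A : Fin n → Fin n → Bool) : Fin n → Fin n → Set where
  stay : ∀ {x} → Walk A x x
  step : ∀ {x y z} → T (symAdj A x y) → Walk A y z → Walk A x z

Connected : ∀ {n} → (Fin n → Fin n → Bool) → Set
Connected {n} A = ∀ (x y : Fin n) → Walk A x y

-- 2 / d  (d = 0 never occurs for t(b) of an actual arc b; set to 0 there)
twoOver : ℕ → ℚ
twoOver zero = 0ℚ
twoOver (suc m) = (+ 2) / suc m

δ : Bool → ℚ
δ b = if b then 1ℚ else 0ℚ

_≟ₚ_ : ∀ {n} → (a b : Pair n) → Dec (a ≡ b)
_≟ₚ_ = ≡-dec _≟ᶠ_ _≟ᶠ_

U : ∀ {n} → (Fin n → Fin n → Bool) → Pair n → Pair n → ℚ
U A a b = (twoOver (deg A (t b)) * δ (does (t b ≟ᶠ o a))) - δ (does (inv a ≟ₚ b))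

allPairs : (n : ℕ) → List (Pair n)
allPairs n = concatMap (λ u → map (λ v → (u , v)) (allFin n)) (allFin n)

InCalA : ∀ {n} → (Fin n → Fin n → Bool) → Pair n → Pair n → Pair n → Set
InCalA A a b z = IsArc± A z × ¬ (U A a z * U A z b ≡ 0ℚ)

inCalA? : ∀ {n} (A : Fin n → Fin n → Bool) (a b z : Pair n) → Dec (InCalA A a b z)
inCalA? A a b z = T? (symAdj A (o z) (t z)) Relation.Nullary.×-dec ¬? ((U A a z * U A z b) ≟ℚ 0ℚ)

cardCalA : ∀ {n} → (Fin n → Fin n → Bool) → Pair n → Pair n → ℕ
cardCalA {n} A a b = length (filter (inCalA? A a b) (allPairs n))

ExactlyOne : Set → Set → Set → Set → Set
ExactlyOne P Q R S =
  (P × ¬ Q × ¬ R × ¬ S) ⊎ (¬ P × Q × ¬ R × ¬ S) ⊎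
  (¬ P × ¬ Q × R × ¬ S) ⊎ (¬ P × ¬ Q × ¬ R × S)

module Submission where

-- U_{az} = (2/deg t(z)) δ_{t(z),o(a)} − δ_{a⁻¹,z} vanishes unless
-- t(z) = o(a); conversely, when t(z) = o(a) it equals 2/d or 2/d − 1 with
-- d = deg t(z) ≥ 3, and neither is zero.  Hence U_{az} U_{zb} ≠ 0 exactly when
-- z = (t(b), o(a)), so 𝒜(a,b) ⊆ {(t(b), o(a))}, and it is all of that set iff
-- t(b) ~ o(a) in G^±.  The four cases (i)–(iv) are a partition of the
-- situations in which t(b) ~ o(a): cases (i)–(iii) force it because a and b
-- are arcs, and (iv) is the remaining case.
--
-- The theorem combines them.

open import Defs
open import Data.Bool using (Bool; true; false; T)
open import Data.Bool.Properties using (∨-comm)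
open import Data.Nat using (ℕ; suc; _≤_; z≤n; s≤s)
open import Data.Nat.Properties using (≤-antisym; >⇒≢)
open import Data.Empty using (⊥-elim)
open import Data.Fin using (Fin) renaming (_≟_ to _≟ᶠ_)
open import Data.Integer using (+_)
open import Data.Integer.Properties using (+-injective; *-zeroˡ)
open import Data.Integer.GCD using (gcd)
open import Data.Rational using (ℚ; 0ℚ; 1ℚ; _-_; _*_; 1/_)
open import Data.Rational.Base using (≢-nonZero)
open import Data.Rational.Properties as ℚ using (+-0-group; ↥-/; ↧-/)
open import Algebra.Properties.Group +-0-group using (x∙y⁻¹≈ε⇒x≈y)
open import Data.Product using (Σ; _×_; _,_; proj₁; proj₂)
open import Data.Sum using (inj₁; inj₂)
open import Data.List using (List; []; _∷_; _++_; length; filter; map; concatMap; cartesianProduct; allFin)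
open import Data.List.Membership.Propositional using (_∈_)
open import Data.List.Membership.Propositional.Properties
  using (∈-filter⁺; ∈-filter⁻; ∈-allFin; ∈-cartesianProduct⁺; ∈-length)
open import Data.List.Relation.Unary.Any using (here; there)
open import Data.List.Relation.Unary.All using (_∷_)
open import Data.List.Relation.Unary.Unique.Propositional using (Unique; _∷_)
open import Data.List.Relation.Unary.Unique.Propositional.Properties
  using (filter⁺; cartesianProduct⁺; allFin⁺)
open import Relation.Nullary using (¬_; yes; no; does)
open import Relation.Nullary.Decidable using (dec-true; dec-false; decidable-stable)
open import Relation.Unary using (Pred; Decidable)
open import Relation.Binary.PropositionalEquality
  using (_≡_; _≢_; refl; sym; trans; cong; cong₂; subst; module ≡-Reasoning)
open import Function.Bundles using (_⇔_; mk⇔; Equivalence)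

-- 2/d is nonzero for every positive d: its numerator times a gcd equals 2.
twoOver-≢0 : ∀ m → twoOver (suc m) ≢ 0ℚ
twoOver-≢0 m 2/d≡0 with ↥-/ (+ 2) (suc m)
... | numerator-eq rewrite 2/d≡0 with trans (sym (*-zeroˡ (gcd (+ 2) (+ suc m)))) numerator-eq
... | ()

-- 2/d = 1 only for d = 2: numerator and denominator of 2/d, scaled by the
-- same gcd, are 2 and d.
twoOver-≢1 : ∀ m → suc m ≢ 2 → twoOver (suc m) ≢ 1ℚ
twoOver-≢1 m d≢2 2/d≡1 with ↥-/ (+ 2) (suc m) | ↧-/ (+ 2) (suc m)
... | numerator-eq | denominator-eq rewrite 2/d≡1 =
  d≢2 (sym (+-injective (trans (sym numerator-eq) denominator-eq)))

*-≢0 : ∀ p q → p ≢ 0ℚ → q ≢ 0ℚ → p * q ≢ 0ℚ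
*-≢0 p q p≢0 q≢0 pq≡0 = q≢0 (begin
    q                ≡⟨ sym (ℚ.*-identityˡ q) ⟩
    1ℚ * q           ≡⟨ cong (_* q) (sym (ℚ.*-inverseˡ p)) ⟩
    (1/ p) * p * q   ≡⟨ ℚ.*-assoc (1/ p) p q ⟩
    (1/ p) * (p * q) ≡⟨ cong ((1/ p) *_) pq≡0 ⟩
    (1/ p) * 0ℚ      ≡⟨ ℚ.*-zeroʳ (1/ p) ⟩
    0ℚ               ∎)
  where
  open ≡-Reasoning
  instance p-nonZero = ≢-nonZero p≢0

minus-δ-≢0 : ∀ p b → p ≢ 0ℚ → p ≢ 1ℚ → p - δ b ≢ 0ℚ
minus-δ-≢0 p true  _   p≢1 p-1≡0 = p≢1 (x∙y⁻¹≈ε⇒x≈y p 1ℚ p-1≡0)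
minus-δ-≢0 p false p≢0 _   p-0≡0 = p≢0 (trans (sym (ℚ.+-identityʳ p)) p-0≡0)

module _ {n : ℕ} (A : Fin n → Fin n → Bool) where

  inv-target : ∀ (a z : Pair n) → inv a ≡ z → t z ≡ o a
  inv-target _ _ refl = refl

  U-off-support : ∀ a z → t z ≢ o a → U A a z ≡ 0ℚ
  U-off-support a z tz≢oa = begin
    U A a z                                   ≡⟨ cong₂ (λ x y → d * δ x - δ y) no-vertex-match no-reversal ⟩
    d * 0ℚ - 0ℚ                               ≡⟨ ℚ.+-identityʳ (d * 0ℚ) ⟩
    d * 0ℚ                                    ≡⟨ ℚ.*-zeroʳ d ⟩
    0ℚ                                        ∎
    where
    open ≡-Reasoning
    d : ℚ
    d = twoOver (deg A (t z))
    no-vertex-match : does (t z ≟ᶠ o a) ≡ false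
    no-vertex-match = dec-false (t z ≟ᶠ o a) tz≢oa
    no-reversal : does (inv a ≟ₚ z) ≡ false
    no-reversal = dec-false (inv a ≟ₚ z) (λ a⁻¹≡z → tz≢oa (inv-target a z a⁻¹≡z))

  U-support : ∀ a z → U A a z ≢ 0ℚ → t z ≡ o a
  U-support a z Uaz≢0 =
    decidable-stable (t z ≟ᶠ o a) (λ tz≢oa → Uaz≢0 (U-off-support a z tz≢oa))

  U-on-support : ∀ a z → t z ≡ o a → U A a z ≡ twoOver (deg A (t z)) - δ (does (inv a ≟ₚ z))
  U-on-support a z tz≡oa = begin
    d * δ (does (t z ≟ᶠ o a)) - δ (does (inv a ≟ₚ z)) ≡⟨ cong (λ x → d * δ x - δ (does (inv a ≟ₚ z))) (dec-true (t z ≟ᶠ o a) tz≡oa) ⟩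
    d * 1ℚ - δ (does (inv a ≟ₚ z))                    ≡⟨ cong (_- δ (does (inv a ≟ₚ z))) (ℚ.*-identityʳ d) ⟩
    d - δ (does (inv a ≟ₚ z))                         ∎
    where
    open ≡-Reasoning
    d : ℚ
    d = twoOver (deg A (t z))

  U-nonzero : ∀ a z → 3 ≤ deg A (t z) → t z ≡ o a → U A a z ≢ 0ℚ
  U-nonzero a z 3≤d tz≡oa rewrite U-on-support a z tz≡oa with deg A (t z) | 3≤d
  ... | suc m | 3≤d′ =
    minus-δ-≢0 (twoOver (suc m)) (does (inv a ≟ₚ z))
      (twoOver-≢0 m) (twoOver-≢1 m (>⇒≢ 3≤d′))

-- The only possible element of 𝒜(a,b): the pair from t(b) to o(a).
bridge : ∀ {n} → Pair n → Pair n → Pair n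
bridge a b = (t b , o a)

module _ {n : ℕ} (A : Fin n → Fin n → Bool) (a b : Pair n) where

  -- Both factors of U_{az} U_{zb} must be nonzero, so t(z) = o(a) and
  -- o(z) = t(b) by the support lemma.
  calA⊆bridge : ∀ z → InCalA A a b z → z ≡ bridge a b
  calA⊆bridge z (_ , product≢0) =
    cong₂ _,_ (sym (U-support A z b Uzb≢0)) (U-support A a z Uaz≢0)
    where
    Uaz≢0 : U A a z ≢ 0ℚ
    Uaz≢0 Uaz≡0 = product≢0 (trans (cong (_* U A z b) Uaz≡0) (ℚ.*-zeroˡ (U A z b)))
    Uzb≢0 : U A z b ≢ 0ℚ
    Uzb≢0 Uzb≡0 = product≢0 (trans (cong (U A a z *_) Uzb≡0) (ℚ.*-zeroʳ (U A a z)))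

  bridge∈calA : (∀ v → 3 ≤ deg A v) → IsArc± A (bridge a b) → InCalA A a b (bridge a b)
  bridge∈calA deg≥3 bridge-arc =
    bridge-arc , *-≢0 (U A a (bridge a b)) (U A (bridge a b) b)
      (U-nonzero A a (bridge a b) (deg≥3 (o a)) refl)
      (U-nonzero A (bridge a b) b (deg≥3 (t b)) refl)

allPairs≡cartesianProduct : ∀ {n} (us vs : List (Fin n)) →
  concatMap (λ u → map (λ v → (u , v)) vs) us ≡ cartesianProduct us vs
allPairs≡cartesianProduct []       vs = refl
allPairs≡cartesianProduct (u ∷ us) vs =
  cong (map (λ v → (u , v)) vs ++_) (allPairs≡cartesianProduct us vs)

allPairs-unique : ∀ n → Unique (allPairs n)
allPairs-unique n = subst Unique (sym (allPairs≡cartesianProduct (allFin n) (allFin n)))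
  (cartesianProduct⁺ (allFin⁺ n) (allFin⁺ n))

allPairs-complete : ∀ {n} (c : Pair n) → c ∈ allPairs n
allPairs-complete {n} (u , v) = subst ((u , v) ∈_) (sym (allPairs≡cartesianProduct (allFin n) (allFin n)))
  (∈-cartesianProduct⁺ (∈-allFin u) (∈-allFin v))

unique-constant-length≤1 : ∀ {X : Set} {c : X} (ys : List X) → Unique ys →
  (∀ y → y ∈ ys → y ≡ c) → length ys ≤ 1
unique-constant-length≤1 []               _                _        = z≤n
unique-constant-length≤1 (_ ∷ [])         _                _        = s≤s z≤n
unique-constant-length≤1 (y₁ ∷ y₂ ∷ _) ((y₁≢y₂ ∷ _) ∷ _) all≡c =
  ⊥-elim (y₁≢y₂ (trans (all≡c y₁ (here refl)) (sym (all≡c y₂ (there (here refl))))))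

length≡1⇒member : ∀ {X : Set} (ys : List X) → length ys ≡ 1 → Σ X (_∈ ys)
length≡1⇒member (y ∷ _) _ = y , here refl

filter-count : ∀ {X : Set} {p} {P : Pred X p} (P? : Decidable P) {xs : List X} {c : X} →
  Unique xs → c ∈ xs → (∀ z → P z → z ≡ c) →
  (length (filter P? xs) ≤ 1) × (length (filter P? xs) ≡ 1 ⇔ P c)
filter-count {P = P} P? {xs} {c} xs-unique c∈xs P⇒≡c = at-most-one , mk⇔ one⇒Pc Pc⇒one
  where
  at-most-one : length (filter P? xs) ≤ 1
  at-most-one = unique-constant-length≤1 (filter P? xs) (filter⁺ P? xs-unique)
    (λ y y∈ → P⇒≡c y (proj₂ (∈-filter⁻ P? {xs = xs} y∈)))

  one⇒Pc : length (filter P? xs) ≡ 1 → P c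
  one⇒Pc one with length≡1⇒member (filter P? xs) one
  ... | y , y∈ = let Py = proj₂ (∈-filter⁻ P? {xs = xs} y∈) in subst P (P⇒≡c y Py) Py

  Pc⇒one : P c → length (filter P? xs) ≡ 1
  Pc⇒one Pc = ≤-antisym at-most-one (∈-length (∈-filter⁺ P? c∈xs Pc))

Cases : ∀ {n} → (Fin n → Fin n → Bool) → Pair n → Pair n → Set
Cases A a b = ExactlyOne (a ≡ b) (o a ≡ o b × a ≢ b) (t a ≡ t b × a ≢ b)
  (T (symAdj A (t b) (o a)) × a ≢ b × ¬ (o a ≡ o b × a ≢ b) × ¬ (t a ≡ t b × a ≢ b))

symAdj-sym : ∀ {n} (A : Fin n → Fin n → Bool) x y → T (symAdj A x y) → T (symAdj A y x)
symAdj-sym A x y = subst T (∨-comm (A x y) (A y x))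

module _ {n : ℕ} (A : Fin n → Fin n → Bool) (a b : Pair n) where

  -- In each of the cases (i)–(iii), t(b) ~ o(a) because a or b is an arc
  -- joining them; in case (iv) it is assumed.
  cases⇒adjacent : IsArc± A a → IsArc± A b → Cases A a b → T (symAdj A (t b) (o a))
  cases⇒adjacent a-arc _ (inj₁ (refl , _)) = symAdj-sym A (o a) (t a) a-arc
  cases⇒adjacent _ b-arc (inj₂ (inj₁ (_ , (oa≡ob , _) , _))) =
    subst (λ x → T (symAdj A (t b) x)) (sym oa≡ob) (symAdj-sym A (o b) (t b) b-arc)
  cases⇒adjacent a-arc _ (inj₂ (inj₂ (inj₁ (_ , _ , (ta≡tb , _) , _)))) =
    subst (λ x → T (symAdj A x (o a))) ta≡tb (symAdj-sym A (o a) (t a) a-arc)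
  cases⇒adjacent _ _ (inj₂ (inj₂ (inj₂ (_ , _ , _ , (adjacent , _))))) = adjacent

  -- Conversely, if t(b) ~ o(a) then deciding a = b, o(a) = o(b), t(a) = t(b)
  -- in turn singles out exactly one case; o(a) = o(b) and t(a) = t(b)
  -- together would give a = b.
  adjacent⇒cases : T (symAdj A (t b) (o a)) → Cases A a b
  adjacent⇒cases adjacent with a ≟ₚ b | o a ≟ᶠ o b | t a ≟ᶠ t b
  ... | yes a≡b | _ | _ =
    inj₁ (a≡b , (λ ii → proj₂ ii a≡b) , (λ iii → proj₂ iii a≡b) , (λ iv → proj₁ (proj₂ iv) a≡b))
  ... | no a≢b | yes oa≡ob | _ =
    inj₂ (inj₁ (a≢b , (oa≡ob , a≢b) , (λ iii → a≢b (cong₂ _,_ oa≡ob (proj₁ iii))) ,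
      (λ iv → proj₁ (proj₂ (proj₂ iv)) (oa≡ob , a≢b))))
  ... | no a≢b | no oa≢ob | yes ta≡tb =
    inj₂ (inj₂ (inj₁ (a≢b , (λ ii → oa≢ob (proj₁ ii)) , (ta≡tb , a≢b) ,
      (λ iv → proj₂ (proj₂ (proj₂ iv)) (ta≡tb , a≢b)))))
  ... | no a≢b | no oa≢ob | no ta≢tb =
    inj₂ (inj₂ (inj₂ (a≢b , not-ii , not-iii , (adjacent , a≢b , not-ii , not-iii))))
    where
    not-ii : ¬ (o a ≡ o b × a ≢ b)
    not-ii ii = oa≢ob (proj₁ ii)
    not-iii : ¬ (t a ≡ t b × a ≢ b)
    not-iii iii = ta≢tb (proj₁ iii)

lemma6p6 : (n k : ℕ) → 3 ≤ k → (A : Fin n → Fin n → Bool)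
    → (∀ x → A x x ≡ false) → Connected A → Regular A k
    → (a b : Pair n) → IsArc± A a → IsArc± A b
    → (cardCalA A a b ≤ 1)
      × (cardCalA A a b ≡ 1
         ⇔ ExactlyOne (a ≡ b) (o a ≡ o b × a ≢ b) (t a ≡ t b × a ≢ b)
             (T (symAdj A (t b) (o a)) × a ≢ b × ¬ (o a ≡ o b × a ≢ b) × ¬ (t a ≡ t b × a ≢ b)))
lemma6p6 n k 3≤k A _ _ regular a b a-arc b-arc =
  card≤1 , mk⇔ (λ card≡1 → adjacent⇒cases A a b (proj₁ (Equivalence.to card≡1⇔bridge card≡1)))
                (λ cases → Equivalence.from card≡1⇔bridge
                  (bridge∈calA A a b deg≥3 (cases⇒adjacent A a b a-arc b-arc cases)))
  where
  deg≥3 : ∀ v → 3 ≤ deg A v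
  deg≥3 v = subst (3 ≤_) (sym (regular v)) 3≤k

  counted : (cardCalA A a b ≤ 1) × (cardCalA A a b ≡ 1 ⇔ InCalA A a b (bridge a b))
  counted = filter-count (inCalA? A a b) (allPairs-unique n) (allPairs-complete (bridge a b))
    (calA⊆bridge A a b)

  card≤1 : cardCalA A a b ≤ 1
  card≤1 = proj₁ counted

  card≡1⇔bridge : cardCalA A a b ≡ 1 ⇔ InCalA A a b (bridge a b)
  card≡1⇔bridge = proj₂ counted
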